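{- For every integer $n \geq 4$, the McPherson number of the cycle $C_n$ on $n$ vertices is $\Upsilon(C_n) = n-2$.
   Context: Vertex explosions: start with $G'_0 = G$ (with underlying graph $G^*_0 = G$). Given the mixed graph $G'_i$ (the graph $G$ together with the arcs added so far) with underlying simple graph $G^*_i$, exploding a vertex $w$ produces $G'_{i+1}$ by adding an arc $(w,z)$ for every vertex $z \neq w$ that is not adjacent to $w$ in $G^*_i$. The McPherson number $\Upsilon(G)$ of a graph $G$ on $n$ vertices is the minimum number $\ell$ of successive vertex explosions after which the underlying graph $G^*_\ell$ is isomorphic to the complete graph $K_n$. -}

module Defs where

open import Data.Nat using (ℕ; zero; suc; _<_)
open import Data.Fin using (Fin; toℕ)
open import Data.List using (List; []; _∷_; length)
open import Data.Product using (_×_; Σ; ∃; _,_)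
open import Data.Sum using (_⊎_)
open import Relation.Nullary using (¬_)
open import Relation.Binary.PropositionalEquality using (_≡_; _≢_)
open import Function.Bundles using (_↔_; Inverse)

Graph : ℕ → Set₁
Graph n = Fin n → Fin n → Set

K : (n : ℕ) → Graph n
K n x y = x ≢ y

_≅_ : {n m : ℕ} → Graph n → Graph m → Set
_≅_ {n} {m} G H =
  Σ (Fin n ↔ Fin m) λ f →
    ∀ x y → (G x y → H (Inverse.to f x) (Inverse.to f y))
          × (H (Inverse.to f x) (Inverse.to f y) → G x y)

Cycle : (n : ℕ) → Graph n
Cycle n x y =
  suc (toℕ x) ≡ toℕ y ⊎ suc (toℕ y) ≡ toℕ x
  ⊎ (toℕ x ≡ 0 × suc (toℕ y) ≡ n) ⊎ (toℕ y ≡ 0 × suc (toℕ x) ≡ n)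

-- Underlying simple graph after exploding vertex w: the arc (w,z) is added for
-- every z ≠ w not adjacent to w in the current underlying graph.
explode : {n : ℕ} → Graph n → Fin n → Graph n
explode G w x y =
  G x y ⊎ (x ≢ y × ((x ≡ w × ¬ G w y) ⊎ (y ≡ w × ¬ G w x)))

explodeAll : {n : ℕ} → Graph n → List (Fin n) → Graph n
explodeAll G []       = G
explodeAll G (w ∷ ws) = explodeAll (explode G w) ws

ExplodableIn : {n : ℕ} → Graph n → ℕ → Set
ExplodableIn {n} G ℓ =
  Σ (List (Fin n)) λ ws → (length ws ≡ ℓ) × (explodeAll G ws ≅ K n)

McPherson : {n : ℕ} → Graph n → ℕ → Set
McPherson G ℓ = ExplodableIn G ℓ × (∀ m → m < ℓ → ¬ ExplodableIn G m)

-- Exploding w makes w adjacent to every other vertex, and an edge of the exploded graph is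
-- an edge of G or has an exploded endpoint. Hence exploding the vertices of a list ws makes G
-- complete exactly when the vertices outside ws form a clique of G. For C_n it suffices to
-- explode all vertices but the adjacent pair 0, 1; conversely C_n is triangle-free for n ≥ 4,
-- so at most two vertices can stay unexploded, and n - 2 explosions are necessary.
module Submission where

open import Defs
open import Data.Nat as ℕ using (ℕ; zero; suc; z≤n; s≤s; _≤_; _<_; _+_; _∸_; _≤?_)
open import Data.Nat.Properties using (<-irrefl; ≰⇒>; <⇒≱; ≤-refl; +-monoˡ-≤; module ≤-Reasoning)
open import Data.Fin using (Fin; zero; suc; toℕ; _≟_)
open import Data.Fin.Properties using (pigeonhole; toℕ-injective; toℕ<n; <⇒≢; any?)
open import Data.List using (List; []; _∷_; _++_; length; tabulate)
open import Data.List.Properties using (length-++; length-tabulate)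
open import Data.List.Membership.Propositional using (_∈_; _∉_)
open import Data.List.Membership.Propositional.Properties using (∈-tabulate⁺; ∈-++⁺ˡ; ∈-++⁺ʳ)
import Data.List.Membership.DecPropositional as DecMembership
open import Data.List.Membership.Setoid.Properties using (index-injective)
open import Data.List.Relation.Unary.Any as Any using (here; there)
open import Data.Product using (_×_; _,_; ∃; proj₂)
open import Data.Sum using (_⊎_; inj₁; inj₂; [_,_]′)
open import Data.Empty using (⊥; ⊥-elim)
open import Relation.Nullary using (¬_; yes; no)
open import Relation.Nullary.Decidable using (_⊎-dec_; _×-dec_; ¬?)
open import Relation.Binary.Definitions using (Decidable; Symmetric; Irreflexive)
open import Relation.Binary.PropositionalEquality using (_≡_; _≢_; refl; ≢-sym; setoid)
open import Function.Bundles using (Injection)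
open import Function.Properties.Inverse using (↔⇒↣)
open import Function.Construct.Identity using (↔-id)

Complete : {n : ℕ} → Graph n → Set
Complete G = ∀ {x y} → x ≢ y → G x y

TriangleFree : {n : ℕ} → Graph n → Set
TriangleFree G = ∀ {x y z} → x ≢ y → y ≢ z → x ≢ z → G x y → G y z → G x z → ⊥

explodeAll-preserves : {n : ℕ} (P : Graph n → Set) → (∀ {G} w → P G → P (explode G w)) →
                       ∀ {G} ws → P G → P (explodeAll G ws)
explodeAll-preserves P preserve []       p = p
explodeAll-preserves P preserve (w ∷ ws) p = explodeAll-preserves P preserve ws (preserve w p)

explode-dec : {n : ℕ} {G : Graph n} (w : Fin n) → Decidable G → Decidable (explode G w)
explode-dec w G? x y =
  G? x y ⊎-dec (¬? (x ≟ y) ×-dec ((x ≟ w ×-dec ¬? (G? w y)) ⊎-dec (y ≟ w ×-dec ¬? (G? w x))))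

explode-sym : {n : ℕ} {G : Graph n} (w : Fin n) → Symmetric G → Symmetric (explode G w)
explode-sym w G-sym (inj₁ g)               = inj₁ (G-sym g)
explode-sym w G-sym (inj₂ (x≢y , inj₁ p)) = inj₂ (≢-sym x≢y , inj₂ p)
explode-sym w G-sym (inj₂ (x≢y , inj₂ p)) = inj₂ (≢-sym x≢y , inj₁ p)

explode-irrefl : {n : ℕ} {G : Graph n} (w : Fin n) → Irreflexive _≡_ G → Irreflexive _≡_ (explode G w)
explode-irrefl w G-irr x≡y (inj₁ g)          = G-irr x≡y g
explode-irrefl w G-irr x≡y (inj₂ (x≢y , _)) = x≢y x≡y

explodeAll-mono : {n : ℕ} {G : Graph n} (ws : List (Fin n)) {x y : Fin n} → G x y → explodeAll G ws x y
explodeAll-mono []       g = g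
explodeAll-mono (w ∷ ws) g = explodeAll-mono ws (inj₁ g)

explodeAll-sound : {n : ℕ} {G : Graph n} (ws : List (Fin n)) {x y : Fin n} →
                   explodeAll G ws x y → G x y ⊎ x ∈ ws ⊎ y ∈ ws
explodeAll-sound []       e = inj₁ e
explodeAll-sound {G = G} (w ∷ ws) e with explodeAll-sound {G = explode G w} ws e
... | inj₁ (inj₁ g)                    = inj₁ g
... | inj₁ (inj₂ (_ , inj₁ (x≡w , _))) = inj₂ (inj₁ (here x≡w))
... | inj₁ (inj₂ (_ , inj₂ (y≡w , _))) = inj₂ (inj₂ (here y≡w))
... | inj₂ (inj₁ x∈ws)                 = inj₂ (inj₁ (there x∈ws))
... | inj₂ (inj₂ y∈ws)                 = inj₂ (inj₂ (there y∈ws))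

explode-saturates : {n : ℕ} {G : Graph n} {w x : Fin n} → Decidable G → w ≢ x → explode G w w x
explode-saturates {w = w} {x} G? w≢x with G? w x
... | yes g = inj₁ g
... | no ¬g = inj₂ (w≢x , inj₁ (refl , ¬g))

explodeAll-saturates : {n : ℕ} {G : Graph n} {ws : List (Fin n)} {w x : Fin n} →
                       Decidable G → w ∈ ws → w ≢ x → explodeAll G ws w x
explodeAll-saturates {ws = _ ∷ ws} G? (here refl)  w≢x = explodeAll-mono ws (explode-saturates G? w≢x)
explodeAll-saturates {ws = w ∷ _}  G? (there w∈ws) w≢x = explodeAll-saturates (explode-dec w G?) w∈ws w≢x

explodeAll-complete : {n : ℕ} {G : Graph n} {ws : List (Fin n)} → Decidable G → Symmetric G →
                      (∀ {x y} → x ≢ y → G x y ⊎ x ∈ ws ⊎ y ∈ ws) → Complete (explodeAll G ws)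
explodeAll-complete {ws = ws} G? G-sym covered x≢y with covered x≢y
... | inj₁ g           = explodeAll-mono ws g
... | inj₂ (inj₁ x∈ws) = explodeAll-saturates G? x∈ws x≢y
... | inj₂ (inj₂ y∈ws) =
  explodeAll-preserves Symmetric explode-sym ws G-sym (explodeAll-saturates G? y∈ws (≢-sym x≢y))

complete⇒≅K : {n : ℕ} {G : Graph n} → Irreflexive _≡_ G → Complete G → G ≅ K n
complete⇒≅K G-irr G-complete = ↔-id _ , λ x y → (λ g x≡y → G-irr x≡y g) , G-complete

≅K⇒complete : {n : ℕ} {G : Graph n} → G ≅ K n → Complete G
≅K⇒complete (f , preserves) {x} {y} x≢y =
  proj₂ (preserves x y) (λ fx≡fy → x≢y (Injection.injective (↔⇒↣ f) fx≡fy))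

_∈?_ : {n : ℕ} → Decidable (_∈_ {A = Fin n})
_∈?_ = DecMembership._∈?_ _≟_

covering⇒≤length : {n : ℕ} {xs : List (Fin n)} → (∀ v → v ∈ xs) → n ≤ length xs
covering⇒≤length {n} {xs} cover with n ≤? length xs
... | yes n≤ = n≤
... | no n≰ with pigeonhole (≰⇒> n≰) (λ v → Any.index (cover v))
...   | i , j , i<j , same-index =
  ⊥-elim (<⇒≢ i<j (index-injective (setoid (Fin n)) (cover i) (cover j) same-index))

MeetsEveryTriple : {n : ℕ} → List (Fin n) → Set
MeetsEveryTriple ws = ∀ {x y z} → x ≢ y → y ≢ z → x ≢ z → x ∉ ws → y ∉ ws → z ∉ ws → ⊥

at-most-two-outside : {n : ℕ} (ws : List (Fin n)) → MeetsEveryTriple ws →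
                      ∃ λ xs → length xs ≤ 2 × (∀ v → v ∉ ws → v ∈ xs)
at-most-two-outside ws no-three with any? (λ a → ¬? (a ∈? ws))
... | no none = [] , z≤n , λ v v∉ws → ⊥-elim (none (v , v∉ws))
... | yes (a , a∉ws) with any? (λ b → ¬? (b ∈? ws) ×-dec ¬? (b ≟ a))
...   | no none-but-a = a ∷ [] , s≤s z≤n , only-a
  where
  only-a : ∀ v → v ∉ ws → v ∈ a ∷ []
  only-a v v∉ws with v ≟ a
  ... | yes v≡a = here v≡a
  ... | no v≢a  = ⊥-elim (none-but-a (v , v∉ws , v≢a))
...   | yes (b , b∉ws , b≢a) = a ∷ b ∷ [] , ≤-refl , a-or-b
  where
  a-or-b : ∀ v → v ∉ ws → v ∈ a ∷ b ∷ []
  a-or-b v v∉ws with v ≟ a | v ≟ b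
  ... | yes v≡a | _       = here v≡a
  ... | no _    | yes v≡b = there (here v≡b)
  ... | no v≢a  | no v≢b  = ⊥-elim (no-three (≢-sym b≢a) (≢-sym v≢b) (≢-sym v≢a) a∉ws b∉ws v∉ws)

meetsEveryTriple⇒≤ : {n : ℕ} (ws : List (Fin n)) → MeetsEveryTriple ws → n ≤ 2 + length ws
meetsEveryTriple⇒≤ {n} ws no-three with at-most-two-outside ws no-three
... | xs , |xs|≤2 , outside⊆xs = begin
  n                       ≤⟨ covering⇒≤length xs++ws-covers ⟩
  length (xs ++ ws)       ≡⟨ length-++ xs ⟩
  length xs + length ws   ≤⟨ +-monoˡ-≤ (length ws) |xs|≤2 ⟩
  2 + length ws           ∎
  where
  open ≤-Reasoning
  xs++ws-covers : ∀ v → v ∈ xs ++ ws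
  xs++ws-covers v with v ∈? ws
  ... | yes v∈ws = ∈-++⁺ʳ xs v∈ws
  ... | no v∉ws  = ∈-++⁺ˡ (outside⊆xs v v∉ws)

complete-explosion⇒clique : {n : ℕ} {G : Graph n} {ws : List (Fin n)} → Complete (explodeAll G ws) →
                            ∀ {x y} → x ≢ y → x ∉ ws → y ∉ ws → G x y
complete-explosion⇒clique {ws = ws} complete x≢y x∉ws y∉ws with explodeAll-sound ws (complete x≢y)
... | inj₁ g           = g
... | inj₂ (inj₁ x∈ws) = ⊥-elim (x∉ws x∈ws)
... | inj₂ (inj₂ y∈ws) = ⊥-elim (y∉ws y∈ws)

triangleFree-explodable⇒≤ : {n m : ℕ} {G : Graph n} → TriangleFree G → ExplodableIn G m → n ≤ 2 + m
triangleFree-explodable⇒≤ {G = G} G-triangleFree (ws , refl , explosion≅K) = meetsEveryTriple⇒≤ ws no-three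
  where
  clique : ∀ {x y} → x ≢ y → x ∉ ws → y ∉ ws → G x y
  clique = complete-explosion⇒clique (≅K⇒complete explosion≅K)
  no-three : MeetsEveryTriple ws
  no-three x≢y y≢z x≢z x∉ws y∉ws z∉ws =
    G-triangleFree x≢y y≢z x≢z (clique x≢y x∉ws y∉ws) (clique y≢z y∉ws z∉ws) (clique x≢z x∉ws z∉ws)

Step : ℕ → ℕ → ℕ → Set
Step n a b = suc a ≡ b ⊎ (b ≡ 0 × suc a ≡ n)

cycle⇒step : {n : ℕ} {x y : Fin n} → Cycle n x y → Step n (toℕ x) (toℕ y) ⊎ Step n (toℕ y) (toℕ x)
cycle⇒step (inj₁ e)               = inj₁ (inj₁ e)
cycle⇒step (inj₂ (inj₁ e))        = inj₂ (inj₁ e)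
cycle⇒step (inj₂ (inj₂ (inj₁ e))) = inj₂ (inj₂ e)
cycle⇒step (inj₂ (inj₂ (inj₂ e))) = inj₁ (inj₂ e)

step-irrefl : ∀ {n a} → 1 < n → ¬ Step n a a
step-irrefl _   (inj₁ ())
step-irrefl 1<n (inj₂ (refl , refl)) = <-irrefl refl 1<n

step-functional : ∀ {n a b c} → b < n → c < n → Step n a b → Step n a c → b ≡ c
step-functional _   _   (inj₁ refl)       (inj₁ refl)       = refl
step-functional b<n _   (inj₁ refl)       (inj₂ (_ , refl)) = ⊥-elim (<-irrefl refl b<n)
step-functional _   c<n (inj₂ (_ , refl)) (inj₁ refl)       = ⊥-elim (<-irrefl refl c<n)
step-functional _   _   (inj₂ (refl , _)) (inj₂ (refl , _)) = refl

step-no-3-cycle : ∀ {n a b c} → Step n a b → Step n b c → Step n c a → 4 ≤ n → ⊥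
step-no-3-cycle (inj₁ refl)          (inj₁ refl)          (inj₁ ())
step-no-3-cycle (inj₁ refl)          (inj₁ refl)          (inj₂ (refl , refl)) (s≤s (s≤s (s≤s ())))
step-no-3-cycle (inj₁ refl)          (inj₂ (refl , refl)) (inj₁ refl)          (s≤s (s≤s (s≤s ())))
step-no-3-cycle (inj₁ refl)          (inj₂ (refl , refl)) (inj₂ (refl , ()))
step-no-3-cycle (inj₂ (refl , refl)) (inj₁ refl)          (inj₁ refl)          (s≤s (s≤s (s≤s ())))
step-no-3-cycle (inj₂ (refl , refl)) (inj₁ refl)          (inj₂ (refl , ()))
step-no-3-cycle (inj₂ (refl , refl)) (inj₂ (refl , refl)) _                    (s≤s ())

cycle-triangleFree : {n : ℕ} → 4 ≤ n → TriangleFree (Cycle n)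
cycle-triangleFree {n} 4≤n {x} {y} {z} x≢y y≢z x≢z xy yz xz =
  orient (cycle⇒step xy) (cycle⇒step yz) (cycle⇒step xz)
  where
  same-successor : ∀ {u} v w → Step n (toℕ u) (toℕ v) → Step n (toℕ u) (toℕ w) → v ≡ w
  same-successor v w u→v u→w = toℕ-injective (step-functional (toℕ<n v) (toℕ<n w) u→v u→w)
  -- Every orientation of a triangle has a vertex with two successors or is a directed 3-cycle.
  orient : Step n (toℕ x) (toℕ y) ⊎ Step n (toℕ y) (toℕ x) →
           Step n (toℕ y) (toℕ z) ⊎ Step n (toℕ z) (toℕ y) →
           Step n (toℕ x) (toℕ z) ⊎ Step n (toℕ z) (toℕ x) → ⊥
  orient (inj₁ x→y) (inj₁ y→z) (inj₁ x→z) = y≢z (same-successor y z x→y x→z)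
  orient (inj₁ x→y) (inj₁ y→z) (inj₂ z→x) = step-no-3-cycle x→y y→z z→x 4≤n
  orient (inj₁ x→y) (inj₂ z→y) (inj₁ x→z) = y≢z (same-successor y z x→y x→z)
  orient (inj₁ x→y) (inj₂ z→y) (inj₂ z→x) = x≢y (same-successor x y z→x z→y)
  orient (inj₂ y→x) (inj₁ y→z) _          = x≢z (same-successor x z y→x y→z)
  orient (inj₂ y→x) (inj₂ z→y) (inj₁ x→z) = step-no-3-cycle x→z z→y y→x 4≤n
  orient (inj₂ y→x) (inj₂ z→y) (inj₂ z→x) = x≢y (same-successor x y z→x z→y)

cycle-irrefl : {n : ℕ} → 1 < n → Irreflexive _≡_ (Cycle n)
cycle-irrefl 1<n refl c = [ step-irrefl 1<n , step-irrefl 1<n ]′ (cycle⇒step c)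

cycle-sym : {n : ℕ} → Symmetric (Cycle n)
cycle-sym (inj₁ e)               = inj₂ (inj₁ e)
cycle-sym (inj₂ (inj₁ e))        = inj₁ e
cycle-sym (inj₂ (inj₂ (inj₁ e))) = inj₂ (inj₂ (inj₂ e))
cycle-sym (inj₂ (inj₂ (inj₂ e))) = inj₂ (inj₂ (inj₁ e))

cycle-dec : {n : ℕ} → Decidable (Cycle n)
cycle-dec {n} x y =
  (suc (toℕ x) ℕ.≟ toℕ y) ⊎-dec (suc (toℕ y) ℕ.≟ toℕ x) ⊎-dec
  ((toℕ x ℕ.≟ 0) ×-dec (suc (toℕ y) ℕ.≟ n)) ⊎-dec ((toℕ y ℕ.≟ 0) ×-dec (suc (toℕ x) ℕ.≟ n))

cycle-explodable : ∀ m → ExplodableIn (Cycle (2 + m)) m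
cycle-explodable m = ws , length-tabulate (λ i → suc (suc i)) ,
  complete⇒≅K (explodeAll-preserves (Irreflexive _≡_) explode-irrefl ws (cycle-irrefl (s≤s (s≤s z≤n))))
              (explodeAll-complete cycle-dec cycle-sym covered)
  where
  ws : List (Fin (2 + m))
  ws = tabulate (λ i → suc (suc i))
  covered : ∀ {x y} → x ≢ y → Cycle (2 + m) x y ⊎ x ∈ ws ⊎ y ∈ ws
  covered {suc (suc i)} {_}           _   = inj₂ (inj₁ (∈-tabulate⁺ i))
  covered {_}           {suc (suc j)} _   = inj₂ (inj₂ (∈-tabulate⁺ j))
  covered {zero}        {zero}        0≢0 = ⊥-elim (0≢0 refl)
  covered {zero}        {suc zero}    _   = inj₁ (inj₁ refl)
  covered {suc zero}    {zero}        _   = inj₁ (inj₂ (inj₁ refl))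
  covered {suc zero}    {suc zero}    1≢1 = ⊥-elim (1≢1 refl)

proposition2p6 : (n : ℕ) → 4 ≤ n → McPherson (Cycle n) (n ∸ 2)
proposition2p6 (suc zero) (s≤s ())
proposition2p6 (suc (suc m)) 4≤n = cycle-explodable m , λ ℓ ℓ<m explodable →
  <⇒≱ (s≤s (s≤s ℓ<m)) (triangleFree-explodable⇒≤ (cycle-triangleFree 4≤n) explodable)
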